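{- Let $c \in \{2,3,4\}$. For all natural numbers $a, b \geq 1$ with $(a,b) \neq (1,1)$, the following two identities hold: $$\gcd(a,b) = \left( \left\lfloor \frac{c^{ab(ab+a+b)}}{(c^{a^2 b}-1)(c^{ab^2}-1)} \right\rfloor \bmod c^{ab} \right) - 1,$$ $$\gcd(a,b) = \left( \left( \left(-c^{ab(ab+a+b)}\right) \bmod \left( (c^{a^2 b}-1)(c^{ab^2}-1) \right) \right) \bmod c^{ab} \right) - 2.$$
   Context: $\gcd(a,b)$ denotes the greatest common divisor of $a$ and $b$. For integers $x$ and $m \geq 1$, $x \bmod m$ denotes the least non-negative residue of $x$ modulo $m$, i.e. the unique $r \in \{0,\dots,m-1\}$ with $m \mid x - r$; $\lfloor \cdot \rfloor$ is the floor function. -}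

module Defs where

open import Data.Nat using (ℕ; zero; suc; _+_; _*_; _∸_; _^_; _≤_; NonZero; >-nonZero; z≤n; s≤s)
open import Data.Nat.Properties as NP using ()

data Base : ℕ → Set where
  two   : Base 2
  three : Base 3
  four  : Base 4

base≥2 : ∀ {c} → Base c → 2 ≤ c
base≥2 two   = s≤s (s≤s z≤n)
base≥2 three = s≤s (s≤s z≤n)
base≥2 four  = s≤s (s≤s z≤n)

pow-pred-pos : ∀ c n → 2 ≤ c → 1 ≤ n → 1 ≤ c ^ n ∸ 1
pow-pred-pos c (suc n) 2≤c _ =
  NP.∸-monoˡ-≤ 1 (NP.≤-trans 2≤c (NP.m≤m*n c (c ^ n) {{>-nonZero (NP.m^n>0 c {{c≠0}} n)}}))
  where c≠0 : NonZero c
        c≠0 = >-nonZero (NP.≤-trans (s≤s z≤n) 2≤c)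

e₁ e₂ : ℕ → ℕ → ℕ
e₁ a b = a * a * b
e₂ a b = a * b * b

ex : ℕ → ℕ → ℕ
ex a b = a * b * (a * b + a + b)

den : ℕ → ℕ → ℕ → ℕ
den c a b = (c ^ e₁ a b ∸ 1) * (c ^ e₂ a b ∸ 1)

pos-mul : ∀ {x y} → 1 ≤ x → 1 ≤ y → 1 ≤ x * y
pos-mul {suc x} {suc y} _ _ = s≤s z≤n

e-pos : ∀ a b → 1 ≤ a → 1 ≤ b → 1 ≤ a * a * b
e-pos a b ha hb = pos-mul (pos-mul ha ha) hb

e-pos' : ∀ a b → 1 ≤ a → 1 ≤ b → 1 ≤ a * b * b
e-pos' a b ha hb = pos-mul (pos-mul ha hb) hb

den-nonZero : ∀ {c a b} → Base c → 1 ≤ a → 1 ≤ b → NonZero (den c a b)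
den-nonZero {c} {a} {b} bc ha hb = >-nonZero
  (pos-mul (pow-pred-pos c (e₁ a b) (base≥2 bc) (e-pos a b ha hb))
           (pow-pred-pos c (e₂ a b) (base≥2 bc) (e-pos' a b ha hb)))

pow-nonZero : ∀ {c} → Base c → (n : ℕ) → NonZero (c ^ n)
pow-nonZero {c} bc n = >-nonZero (NP.m^n>0 c n)
  where instance _ : NonZero c
                 _ = >-nonZero (NP.≤-trans (s≤s z≤n) (base≥2 bc))

module Submission where

-- With q = c^(ab), A = q^a and B = q^b the numerator is N = A·B^(a+1) and the
-- denominator is D = (A − 1)(B − 1). Expanding B^(a+1) as a geometric series, writing
-- each q^(a + bk) as q^(bk mod a)·A^(⌊bk/a⌋ + 1) and expanding that power of A again gives
-- N = R + F·D with R = A + (B − 1)·T, T = Σ_{k ≤ a} q^(bk mod a) and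
-- F = Σ_{k ≤ a} q^(bk mod a)·(1 + A + ⋯ + A^⌊bk/a⌋). For b ≥ 2 we have R < D, so F is the
-- quotient, R the remainder and D − R the remainder of −N. Modulo q all positive powers
-- of q vanish, so F ≡ T ≡ #{k ≤ a : a ∣ bk} = gcd(a,b) + 1 and D − R ≡ 1 + T, and both
-- values lie below q. The remaining case b = 1 < a follows by symmetry in a and b.

open import Defs
open import Data.Nat using (ℕ; _*_; _^_; _≤_; _/_; _%_)
open import Data.Nat.GCD using (gcd)
open import Data.Integer using (ℤ; +_; -_; _-_)
open import Data.Integer.DivMod using (_%ℕ_)
open import Data.Product using (_×_)
open import Relation.Binary.PropositionalEquality using (_≡_)
open import Relation.Nullary using (¬_)

open import Data.Nat
  using (zero; suc; pred; _+_; _∸_; _<_; z≤n; s≤s; NonZero; ≢-nonZero; ≢-nonZero⁻¹; >-nonZero; >-nonZero⁻¹)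
open import Data.Nat.Properties
open import Data.Nat.DivMod
open import Data.Nat.Divisibility
open import Data.Nat.GCD using (gcd[m,n]∣m; gcd[m,n]∣n; gcd[m,n]≢0; m/gcd[m,n]≢0; gcd-comm)
open import Algebra.Properties.CommutativeSemigroup +-commutativeSemigroup
  using () renaming (interchange to +-interchange)
open import Algebra.Properties.CommutativeSemigroup *-commutativeSemigroup
  using () renaming (xy∙z≈xz∙y to *-xy∙z≈xz∙y; x∙yz≈xz∙y to *-x∙yz≈xz∙y)
open import Data.Nat.Coprimality using (Coprime; coprime-/gcd; coprime-divisor)
open import Data.Nat.Tactic.RingSolver using (solve; solve-∀)
open import Data.List using (_∷_; [])
open import Data.Product using (_,_; proj₁; proj₂)
open import Data.Sum using (inj₁)
open import Data.Empty using (⊥-elim)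
open import Function.Base using (_∋_)
open import Function.Bundles using (_⇔_; mk⇔; module Equivalence)
open import Function.Construct.Composition using (_⇔-∘_)
open import Function.Construct.Symmetry using (⇔-sym)
open import Relation.Binary.PropositionalEquality
  using (refl; sym; trans; cong; cong₂; subst; subst₂; module ≡-Reasoning)

∑< : ℕ → (ℕ → ℕ) → ℕ
∑< zero    f = 0
∑< (suc n) f = ∑< n f + f n

syntax ∑< n (λ i → e) = ∑[ i < n ] e

∑<-cong : ∀ n {f g : ℕ → ℕ} → (∀ {i} → i < n → f i ≡ g i) → ∑< n f ≡ ∑< n g
∑<-cong zero    eq = refl
∑<-cong (suc n) eq = cong₂ _+_ (∑<-cong n (λ i<n → eq (m<n⇒m<1+n i<n))) (eq (n<1+n n))

∑<-zero : ∀ n {f : ℕ → ℕ} → (∀ {i} → i < n → f i ≡ 0) → ∑< n f ≡ 0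
∑<-zero zero    eq = refl
∑<-zero (suc n) eq = cong₂ _+_ (∑<-zero n (λ i<n → eq (m<n⇒m<1+n i<n))) (eq (n<1+n n))

∑<-distrib-+ : ∀ n (f g : ℕ → ℕ) → ∑[ i < n ] (f i + g i) ≡ ∑< n f + ∑< n g
∑<-distrib-+ zero    f g = refl
∑<-distrib-+ (suc n) f g = begin
  ∑[ i < n ] (f i + g i) + (f n + g n) ≡⟨ cong (_+ (f n + g n)) (∑<-distrib-+ n f g) ⟩
  ∑< n f + ∑< n g + (f n + g n)        ≡⟨ +-interchange (∑< n f) (∑< n g) (f n) (g n) ⟩
  ∑< n f + f n + (∑< n g + g n)        ∎
  where open ≡-Reasoning

*-distribˡ-∑< : ∀ n c (f : ℕ → ℕ) → c * ∑< n f ≡ ∑[ i < n ] (c * f i)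
*-distribˡ-∑< zero    c f = *-zeroʳ c
*-distribˡ-∑< (suc n) c f =
  trans (*-distribˡ-+ c (∑< n f) (f n)) (cong (_+ c * f n) (*-distribˡ-∑< n c f))

∑<-+-split : ∀ m n (f : ℕ → ℕ) → ∑< (m + n) f ≡ ∑< m f + ∑[ i < n ] f (m + i)
∑<-+-split m zero    f = trans (cong (λ k → ∑< k f) (+-identityʳ m)) (sym (+-identityʳ _))
∑<-+-split m (suc n) f = begin
  ∑< (m + suc n) f                          ≡⟨ cong (λ k → ∑< k f) (+-suc m n) ⟩
  ∑< (m + n) f + f (m + n)                  ≡⟨ cong (_+ f (m + n)) (∑<-+-split m n f) ⟩
  ∑< m f + ∑[ i < n ] f (m + i) + f (m + n) ≡⟨ +-assoc (∑< m f) _ _ ⟩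
  ∑< m f + ∑[ i < suc n ] f (m + i)         ∎
  where open ≡-Reasoning

∑<-≤ : ∀ n {f : ℕ → ℕ} {m} → (∀ i → f i ≤ m) → ∑< n f ≤ n * m
∑<-≤ zero            _  = z≤n
∑<-≤ (suc n) {f} {m} le = subst (∑< n f + f n ≤_) (+-comm (n * m) m) (+-mono-≤ (∑<-≤ n le) (le n))

∑<-cong-% : ∀ n {f g : ℕ → ℕ} q .{{_ : NonZero q}} →
            (∀ i → f i % q ≡ g i % q) → ∑< n f % q ≡ ∑< n g % q
∑<-cong-% zero            q eq = refl
∑<-cong-% (suc n) {f} {g} q eq = begin
  (∑< n f + f n) % q         ≡⟨ %-distribˡ-+ (∑< n f) (f n) q ⟩
  (∑< n f % q + f n % q) % q ≡⟨ cong₂ (λ x y → (x + y) % q) (∑<-cong-% n q eq) (eq n) ⟩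
  (∑< n g % q + g n % q) % q ≡⟨ %-distribˡ-+ (∑< n g) (g n) q ⟨
  (∑< n g + g n) % q         ∎
  where open ≡-Reasoning

geometric : ∀ {x} n → 1 ≤ x → x ^ n ≡ 1 + (x ∸ 1) * ∑< n (x ^_)
geometric {suc y} zero    _   = cong suc (sym (*-zeroʳ y))
geometric {suc y} (suc n) 1≤x = begin
  suc y * suc y ^ n          ≡⟨ cong (suc y *_) (geometric n 1≤x) ⟩
  suc y * (1 + y * S)        ≡⟨ distrib y S ⟩
  1 + y * (S + (1 + y * S))  ≡⟨ cong (λ z → 1 + y * (S + z)) (geometric n 1≤x) ⟨
  1 + y * (S + suc y ^ n)    ∎
  where
  open ≡-Reasoning
  S = ∑< n (suc y ^_)
  distrib : ∀ y S → suc y * (1 + y * S) ≡ 1 + y * (S + (1 + y * S))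
  distrib = solve-∀

geometric-% : ∀ {x} m q .{{_ : NonZero q}} → q ∣ x → ∑< (suc m) (x ^_) % q ≡ 1 % q
geometric-%       zero    q _   = refl
geometric-% {x} (suc m) q q∣x =
  trans (%-remove-+ʳ (∑< (suc m) (x ^_)) (∣m⇒∣m*n (x ^ m) q∣x)) (geometric-% m q q∣x)

[_≡0] : ℕ → ℕ
[ zero  ≡0] = 1
[ suc _ ≡0] = 0

[≡0]-cong : ∀ {x y} → x ≡ 0 ⇔ y ≡ 0 → [ x ≡0] ≡ [ y ≡0]
[≡0]-cong {zero}  {zero}  _   = refl
[≡0]-cong {zero}  {suc _} x⇔y with () ← Equivalence.to x⇔y refl
[≡0]-cong {suc _} {zero}  x⇔y with () ← Equivalence.from x⇔y refl
[≡0]-cong {suc _} {suc _} _   = refl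

m^n%m≡[n≡0]%m : ∀ m n .{{_ : NonZero m}} → m ^ n % m ≡ [ n ≡0] % m
m^n%m≡[n≡0]%m m zero    = refl
m^n%m≡[n≡0]%m m (suc n) = trans (n∣m⇒m%n≡0 (m ^ suc n) m (m∣m*n (m ^ n))) (sym (m*n%n≡0 0 m))

multiple-in-block : ∀ p .{{_ : NonZero p}} m → ∑[ i < p ] [ (suc (p * m) + i) % p ≡0] ≡ 1
multiple-in-block p@(suc p₀) m = begin
  ∑< p₀ f + f p₀ ≡⟨ cong (_+ f p₀) (∑<-zero p₀ none-before) ⟩
  f p₀           ≡⟨ cong [_≡0] last-is-multiple ⟩
  1              ∎
  where
  open ≡-Reasoning
  f : ℕ → ℕ
  f i = [ (suc (p * m) + i) % p ≡0]
  shift : ∀ i → suc (p * m) + i ≡ suc i + m * p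
  shift i = solve (p₀ ∷ m ∷ i ∷ [])
  none-before : ∀ {i} → i < p₀ → f i ≡ 0
  none-before {i} i<p₀ = cong [_≡0] (begin
    (suc (p * m) + i) % p ≡⟨ cong (_% p) (shift i) ⟩
    (suc i + m * p) % p   ≡⟨ [m+kn]%n≡m%n (suc i) m p ⟩
    suc i % p             ≡⟨ m<n⇒m%n≡m (s≤s i<p₀) ⟩
    suc i                 ∎)
  last≡ : suc (p * m) + p₀ ≡ suc m * p
  last≡ = solve (p₀ ∷ m ∷ [])
  last-is-multiple : (suc (p * m) + p₀) % p ≡ 0
  last-is-multiple = begin
    (suc (p * m) + p₀) % p ≡⟨ %-congˡ last≡ ⟩
    suc m * p % p          ≡⟨ m*n%n≡0 (suc m) p ⟩
    0                      ∎

count-multiples : ∀ p .{{_ : NonZero p}} m → ∑[ k < suc (p * m) ] [ k % p ≡0] ≡ suc m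
count-multiples (suc p₀) zero    rewrite *-zeroʳ p₀ = refl
count-multiples p        (suc m) = begin
  ∑< (suc (p * suc m)) f                              ≡⟨ cong (λ n → ∑< n f) (solve (p ∷ m ∷ [])) ⟩
  ∑< (suc (p * m) + p) f                              ≡⟨ ∑<-+-split (suc (p * m)) p f ⟩
  ∑< (suc (p * m)) f + ∑[ i < p ] f (suc (p * m) + i) ≡⟨ cong₂ _+_ (count-multiples p m) (multiple-in-block p m) ⟩
  suc m + 1                                           ≡⟨ +-comm (suc m) 1 ⟩
  suc (suc m)                                         ∎
  where
  open ≡-Reasoning
  f : ℕ → ℕ
  f k = [ k % p ≡0]

coprime⇒m*o∣n*o*k⇔m∣k : ∀ {m n} o k .{{_ : NonZero o}} → Coprime m n → m * o ∣ n * o * k ⇔ m ∣ k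
coprime⇒m*o∣n*o*k⇔m∣k {m} {n} o k m⊥n = mk⇔ to from
  where
  to : m * o ∣ n * o * k → m ∣ k
  to mo∣nok = coprime-divisor m⊥n (*-cancelʳ-∣ o (subst (m * o ∣_) (*-xy∙z≈xz∙y n o k) mo∣nok))
  from : m ∣ k → m * o ∣ n * o * k
  from m∣k = subst (m * o ∣_) (*-x∙yz≈xz∙y n k o) (∣n⇒∣m*n n (*-monoˡ-∣ o m∣k))

∣*⇔/gcd∣ : ∀ a b k .{{_ : NonZero (gcd a b)}} → a ∣ b * k ⇔ a / gcd a b ∣ k
∣*⇔/gcd∣ a b k = subst₂ (λ x y → x ∣ y * k ⇔ a / g ∣ k)
                        (m/n*n≡m (gcd[m,n]∣m a b)) (m/n*n≡m (gcd[m,n]∣n a b))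
                        (coprime⇒m*o∣n*o*k⇔m∣k g k (coprime-/gcd a b))
  where g = gcd a b

count-solutions : ∀ a b .{{_ : NonZero a}} → ∑[ k < suc a ] [ b * k % a ≡0] ≡ suc (gcd a b)
count-solutions a b = begin
  ∑[ k < suc a ] [ b * k % a ≡0]       ≡⟨ ∑<-cong (suc a) (λ {k} _ → [≡0]-cong (same-solutions k)) ⟩
  ∑[ k < suc a ] [ k % a′ ≡0]          ≡⟨ cong (λ n → ∑[ k < suc n ] [ k % a′ ≡0]) a≡a′g ⟩
  ∑[ k < suc (a′ * g) ] [ k % a′ ≡0]   ≡⟨ count-multiples a′ g ⟩
  suc g                                ∎
  where
  open ≡-Reasoning
  g  = gcd a b
  instance
    g≢0 : NonZero g
    g≢0 = ≢-nonZero (gcd[m,n]≢0 a b (inj₁ (≢-nonZero⁻¹ a)))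
  a′ = a / g
  instance
    a′≢0 : NonZero a′
    a′≢0 = ≢-nonZero (m/gcd[m,n]≢0 a b)
  a≡a′g : a ≡ a′ * g
  a≡a′g = sym (m/n*n≡m (gcd[m,n]∣m a b))
  same-solutions : ∀ k → b * k % a ≡ 0 ⇔ k % a′ ≡ 0
  same-solutions k = ⇔-sym (m%n≡0⇔n∣m k a′) ⇔-∘ (∣*⇔/gcd∣ a b k ⇔-∘ m%n≡0⇔n∣m (b * k) a)

/-%-unique : ∀ {n r k d} .{{_ : NonZero d}} → n ≡ r + k * d → r < d → n / d ≡ k × n % d ≡ r
/-%-unique {r = r} {k} {d} refl r<d =
  trans (+-distrib-/-∣ʳ r (n∣m*n k)) (cong₂ _+_ (m<n⇒m/n≡0 r<d) (m*n/n≡m k d)) ,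
  trans ([m+kn]%n≡m%n r k d) (m<n⇒m%n≡m r<d)

-[n]%ℕd≡d∸n%d : ∀ n d .{{_ : NonZero d}} → 0 < n % d → (- + n) %ℕ d ≡ d ∸ n % d
-[n]%ℕd≡d∸n%d zero    d 0<r = ⊥-elim (<-irrefl (sym (m*n%n≡0 0 d)) 0<r)
-[n]%ℕd≡d∸n%d (suc n) d 0<r with suc n % d | 0<r
... | suc _ | _ = refl

m+kn≡o+ln⇒m%n≡o%n : ∀ {m o} k l n .{{_ : NonZero n}} → m + k * n ≡ o + l * n → m % n ≡ o % n
m+kn≡o+ln⇒m%n≡o%n {m} {o} k l n eq =
  trans (sym ([m+kn]%n≡m%n m k n)) (trans (%-congˡ eq) ([m+kn]%n≡m%n o l n))

complement-% : ∀ {x t A B u v} q .{{_ : NonZero q}} → A ≡ q * u → B ≡ q * v → 1 ≤ A → 1 ≤ B →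
               x + (A + (B ∸ 1) * t) ≡ (A ∸ 1) * (B ∸ 1) → x % q ≡ suc t % q
complement-% {x} {t} {suc α} {suc β} {u} {v} q A≡qu B≡qv _ _ eq =
  m+kn≡o+ln⇒m%n≡o%n (2 * u + v * suc t) (u * (v * q)) q (begin
    x + (2 * u + v * suc t) * q                ≡⟨ solve (x ∷ u ∷ v ∷ t ∷ q ∷ []) ⟩
    x + (2 * (q * u) + q * v * suc t)          ≡⟨ cong₂ (λ y z → x + (2 * y + z * suc t)) A≡qu B≡qv ⟨
    x + (2 * suc α + suc β * suc t)            ≡⟨ solve (x ∷ α ∷ β ∷ t ∷ []) ⟩
    x + (suc α + β * t) + (suc α + suc β + t)  ≡⟨ cong (_+ (suc α + suc β + t)) eq ⟩
    α * β + (suc α + suc β + t)                ≡⟨ solve (α ∷ β ∷ t ∷ []) ⟩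
    suc t + suc α * suc β                      ≡⟨ cong₂ (λ y z → suc t + y * z) A≡qu B≡qv ⟩
    suc t + q * u * (q * v)                    ≡⟨ solve (t ∷ u ∷ v ∷ q ∷ []) ⟩
    suc t + u * (v * q) * q                    ∎)
  where open ≡-Reasoning

+-%-congʳ : ∀ m {n o} d .{{_ : NonZero d}} → n % d ≡ o % d → (m + n) % d ≡ (m + o) % d
+-%-congʳ m {n} {o} d eq = begin
  (m + n) % d             ≡⟨ %-distribˡ-+ m n d ⟩
  (m % d + n % d) % d     ≡⟨ cong (λ x → (m % d + x) % d) eq ⟩
  (m % d + o % d) % d     ≡⟨ %-distribˡ-+ m o d ⟨
  (m + o) % d             ∎
  where open ≡-Reasoning

n<2^n : ∀ n → n < 2 ^ n
n<2^n zero    = s≤s z≤n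
n<2^n (suc n) = subst (_≤ 2 ^ suc n) (+-comm (suc n) 1)
                  (+-mono-≤ (n<2^n n) (≤-trans (≤-trans (s≤s z≤n) (n<2^n n)) (m≤m+n (2 ^ n) 0)))

2[1+a]≤c^[ab] : ∀ {a b c} → 1 ≤ a → 2 ≤ b → 2 ≤ c → 2 * suc a ≤ c ^ (a * b)
2[1+a]≤c^[ab] {a} {b} {c} 1≤a 2≤b 2≤c = begin
  2 * suc a   ≤⟨ *-monoʳ-≤ 2 (n<2^n a) ⟩
  2 ^ suc a   ≤⟨ ^-monoʳ-≤ 2 1+a≤ab ⟩
  2 ^ (a * b) ≤⟨ ^-monoˡ-≤ (a * b) 2≤c ⟩
  c ^ (a * b) ∎
  where
  open ≤-Reasoning
  1+a≤ab : suc a ≤ a * b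
  1+a≤ab = begin
    suc a ≤⟨ +-monoˡ-≤ a 1≤a ⟩
    a + a ≡⟨ solve (a ∷ []) ⟩
    a * 2 ≤⟨ *-monoʳ-≤ a 2≤b ⟩
    a * b ∎

remainder<den : ∀ {A B t} → 4 ≤ A → 16 ≤ B → 2 * t ≤ A → A + (B ∸ 1) * t < (A ∸ 1) * (B ∸ 1)
remainder<den {t = t} 4≤A 16≤B 2t≤A =
  let x , 4+x≡A  = m≤n⇒∃[o]m+o≡n 4≤A
      y , 16+y≡B = m≤n⇒∃[o]m+o≡n 16≤B
  in subst₂ (λ A B → A + (B ∸ 1) * t < (A ∸ 1) * (B ∸ 1)) 4+x≡A 16+y≡B
            (shifted x y (subst (2 * t ≤_) (sym 4+x≡A) 2t≤A))
  where
  shifted : ∀ x y → 2 * t ≤ 4 + x → 4 + x + (15 + y) * t < (3 + x) * (15 + y)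
  shifted x y 2t≤4+x = *-cancelˡ-≤ 2 (begin
    2 * suc (4 + x + (15 + y) * t)       ≡⟨ solve (x ∷ y ∷ t ∷ []) ⟩
    2 + 2 * (4 + x) + (15 + y) * (2 * t) ≤⟨ +-monoʳ-≤ (2 + 2 * (4 + x)) (*-monoʳ-≤ (15 + y) 2t≤4+x) ⟩
    2 + 2 * (4 + x) + (15 + y) * (4 + x) ≤⟨ m≤m+n _ (20 + 13 * x + 2 * y + x * y) ⟩
    2 + 2 * (4 + x) + (15 + y) * (4 + x) + (20 + 13 * x + 2 * y + x * y) ≡⟨ solve (x ∷ y ∷ []) ⟩
    2 * ((3 + x) * (15 + y))             ∎)
    where open ≤-Reasoning

ex-comm : ∀ a b → ex a b ≡ ex b a
ex-comm a b = (a * b * (a * b + a + b) ≡ b * a * (b * a + b + a)) ∋ solve (a ∷ b ∷ [])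

den-comm : ∀ c a b → den c a b ≡ den c b a
den-comm c a b = trans (*-comm (c ^ e₁ a b ∸ 1) _)
  (cong₂ (λ m n → (c ^ m ∸ 1) * (c ^ n ∸ 1))
         ((a * b * b ≡ b * b * a) ∋ solve (a ∷ b ∷ []))
         ((a * a * b ≡ b * a * a) ∋ solve (a ∷ b ∷ [])))

m^n≡m*m^pred[n] : ∀ m n .{{_ : NonZero n}} → m ^ n ≡ m * m ^ pred n
m^n≡m*m^pred[n] m (suc n) = refl

x*[1+yz]≡x+y[xz] : ∀ x y z → x * (1 + y * z) ≡ x + y * (x * z)
x*[1+yz]≡x+y[xz] = solve-∀

GcdFormulas : (g N D Q : ℕ) .{{_ : NonZero D}} .{{_ : NonZero Q}} → Set
GcdFormulas g N D Q = (N / D) % Q ≡ suc g × ((- + N) %ℕ D) % Q ≡ suc (suc g)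

GcdFormulas-cong : ∀ {g g′ N N′ D D′ Q Q′} .{{_ : NonZero D}} .{{_ : NonZero D′}}
                   .{{_ : NonZero Q}} .{{_ : NonZero Q′}} →
                   g ≡ g′ → N ≡ N′ → D ≡ D′ → Q ≡ Q′ →
                   GcdFormulas g N D Q → GcdFormulas g′ N′ D′ Q′
GcdFormulas-cong refl refl refl refl formulas = formulas

module Expansion (q a b : ℕ) .{{_ : NonZero q}} .{{_ : NonZero a}} where

  A B : ℕ
  A = q ^ a
  B = q ^ b

  t G : ℕ → ℕ
  t k = q ^ (b * k % a)
  G k = ∑< (suc (b * k / a)) (A ^_)

  T F R D N : ℕ
  T = ∑[ k < suc a ] t k
  F = ∑[ k < suc a ] (t k * G k)
  R = A + (B ∸ 1) * T
  D = (A ∸ 1) * (B ∸ 1)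
  N = A * B ^ suc a

  1≤q^ : ∀ n → 1 ≤ q ^ n
  1≤q^ = m^n>0 q

  A*Bᵏ≡t+[A∸1]tG : ∀ k → A * B ^ k ≡ t k + (A ∸ 1) * (t k * G k)
  A*Bᵏ≡t+[A∸1]tG k = begin
    A * B ^ k                             ≡⟨ cong (A *_) (^-*-assoc q b k) ⟩
    q ^ a * q ^ (b * k)                   ≡⟨ ^-distribˡ-+-* q a (b * k) ⟨
    q ^ (a + b * k)                       ≡⟨ cong (q ^_) exponent ⟩
    q ^ (b * k % a + a * suc (b * k / a)) ≡⟨ ^-distribˡ-+-* q (b * k % a) _ ⟩
    t k * q ^ (a * suc (b * k / a))       ≡⟨ cong (t k *_) (^-*-assoc q a _) ⟨
    t k * A ^ suc (b * k / a)             ≡⟨ cong (t k *_) (geometric (suc (b * k / a)) (1≤q^ a)) ⟩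
    t k * (1 + (A ∸ 1) * G k)             ≡⟨ x*[1+yz]≡x+y[xz] (t k) (A ∸ 1) (G k) ⟩
    t k + (A ∸ 1) * (t k * G k)           ∎
    where
    open ≡-Reasoning
    regroup : ∀ a r d → a + (r + d * a) ≡ r + a * suc d
    regroup = solve-∀
    exponent : a + b * k ≡ b * k % a + a * suc (b * k / a)
    exponent = trans (cong (λ n → a + n) (m≡m%n+[m/n]*n (b * k) a)) (regroup a (b * k % a) (b * k / a))

  A*∑Bᵏ≡T+[A∸1]F : A * ∑< (suc a) (B ^_) ≡ T + (A ∸ 1) * F
  A*∑Bᵏ≡T+[A∸1]F = begin
    A * ∑< (suc a) (B ^_)                          ≡⟨ *-distribˡ-∑< (suc a) A (B ^_) ⟩
    ∑[ k < suc a ] (A * B ^ k)                     ≡⟨ ∑<-cong (suc a) (λ {k} _ → A*Bᵏ≡t+[A∸1]tG k) ⟩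
    ∑[ k < suc a ] (t k + (A ∸ 1) * (t k * G k))   ≡⟨ ∑<-distrib-+ (suc a) t _ ⟩
    T + ∑[ k < suc a ] ((A ∸ 1) * (t k * G k))     ≡⟨ cong (λ s → T + s) (*-distribˡ-∑< (suc a) (A ∸ 1) _) ⟨
    T + (A ∸ 1) * F                                ∎
    where open ≡-Reasoning

  N≡R+F*D : N ≡ R + F * D
  N≡R+F*D = begin
    A * B ^ suc a                           ≡⟨ cong (A *_) (geometric (suc a) (1≤q^ b)) ⟩
    A * (1 + (B ∸ 1) * ∑< (suc a) (B ^_))   ≡⟨ x*[1+yz]≡x+y[xz] A (B ∸ 1) _ ⟩
    A + (B ∸ 1) * (A * ∑< (suc a) (B ^_))   ≡⟨ cong (λ s → A + (B ∸ 1) * s) A*∑Bᵏ≡T+[A∸1]F ⟩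
    A + (B ∸ 1) * (T + (A ∸ 1) * F)         ≡⟨ regroup A (B ∸ 1) (A ∸ 1) T F ⟩
    R + F * D                               ∎
    where
    open ≡-Reasoning
    regroup : ∀ x β α T F → x + β * (T + α * F) ≡ (x + β * T) + F * (α * β)
    regroup = solve-∀

  T%q≡[1+gcd]%q : T % q ≡ suc (gcd a b) % q
  T%q≡[1+gcd]%q = trans (∑<-cong-% (suc a) q (λ k → m^n%m≡[n≡0]%m q (b * k % a)))
                        (%-congˡ (count-solutions a b))

  F%q≡T%q : F % q ≡ T % q
  F%q≡T%q = ∑<-cong-% (suc a) q tG%q≡t%q
    where
    open ≡-Reasoning
    q∣A : q ∣ A
    q∣A = subst (q ∣_) (sym (m^n≡m*m^pred[n] q a)) (m∣m*n (q ^ pred a))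
    tG%q≡t%q : ∀ k → t k * G k % q ≡ t k % q
    tG%q≡t%q k = begin
      t k * G k % q             ≡⟨ %-distribˡ-* (t k) (G k) q ⟩
      t k % q * (G k % q) % q   ≡⟨ cong (λ g → t k % q * g % q) (geometric-% (b * k / a) q q∣A) ⟩
      t k % q * (1 % q) % q     ≡⟨ %-distribˡ-* (t k) 1 q ⟨
      t k * 1 % q               ≡⟨ %-congˡ (*-identityʳ (t k)) ⟩
      t k % q                   ∎

  module Reduction (2[1+a]≤q : 2 * suc a ≤ q) (2≤b : 2 ≤ b) where

    1≤a : 1 ≤ a
    1≤a = >-nonZero⁻¹ a

    instance
      b≢0 : NonZero b
      b≢0 = >-nonZero (≤-trans (s≤s z≤n) 2≤b)

    4≤q : 4 ≤ q
    4≤q = ≤-trans (*-monoʳ-≤ 2 (s≤s 1≤a)) 2[1+a]≤q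

    4≤A : 4 ≤ A
    4≤A = ≤-trans 4≤q (subst (q ≤_) (sym (m^n≡m*m^pred[n] q a)) (m≤m*n q (q ^ pred a) {{m^n≢0 q (pred a)}}))

    16≤B : 16 ≤ B
    16≤B = ≤-trans (^-monoˡ-≤ 2 4≤q) (^-monoʳ-≤ q 2≤b)

    2T≤A : 2 * T ≤ A
    2T≤A = begin
      2 * T                    ≤⟨ *-monoʳ-≤ 2 (∑<-≤ (suc a) (λ k → ^-monoʳ-≤ q (<⇒≤pred (m%n<n (b * k) a)))) ⟩
      2 * (suc a * q ^ pred a) ≡⟨ *-assoc 2 (suc a) _ ⟨
      2 * suc a * q ^ pred a   ≤⟨ *-monoˡ-≤ (q ^ pred a) 2[1+a]≤q ⟩
      q * q ^ pred a           ≡⟨ m^n≡m*m^pred[n] q a ⟨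
      A                        ∎
      where open ≤-Reasoning

    R<D : R < D
    R<D = remainder<den 4≤A 16≤B 2T≤A

    instance
      D≢0 : NonZero D
      D≢0 = >-nonZero (≤-trans (s≤s z≤n) R<D)

    N/D≡F×N%D≡R : N / D ≡ F × N % D ≡ R
    N/D≡F×N%D≡R = /-%-unique N≡R+F*D R<D

    3+gcd≤q : suc (suc (gcd a b)) < q
    3+gcd≤q = ≤-trans (s≤s (s≤s (s≤s (∣⇒≤ (gcd[m,n]∣m a b))))) (≤-trans 3+a≤2[1+a] 2[1+a]≤q)
      where
      3+a≤2[1+a] : 3 + a ≤ 2 * suc a
      3+a≤2[1+a] = subst (3 + a ≤_) (cong (λ n → suc a + n) (sym (+-identityʳ (suc a)))) (+-monoˡ-≤ (suc a) (s≤s 1≤a))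

    gcdFormulas : GcdFormulas (gcd a b) N D q
    gcdFormulas = quotient-formula , negated-formula
      where
      open ≡-Reasoning
      g = gcd a b
      quotient-formula : (N / D) % q ≡ suc g
      quotient-formula = begin
        (N / D) % q ≡⟨ %-congˡ (proj₁ N/D≡F×N%D≡R) ⟩
        F % q       ≡⟨ F%q≡T%q ⟩
        T % q       ≡⟨ T%q≡[1+gcd]%q ⟩
        suc g % q   ≡⟨ m<n⇒m%n≡m (<-trans (n<1+n (suc g)) 3+gcd≤q) ⟩
        suc g       ∎
      N%D≡R : N % D ≡ R
      N%D≡R = proj₂ N/D≡F×N%D≡R
      0<N%D : 0 < N % D
      0<N%D = subst (0 <_) (sym N%D≡R) (≤-trans (1≤q^ a) (m≤m+n A _))
      negated-formula : ((- + N) %ℕ D) % q ≡ suc (suc g)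
      negated-formula = begin
        ((- + N) %ℕ D) % q ≡⟨ %-congˡ (-[n]%ℕd≡d∸n%d N D 0<N%D) ⟩
        (D ∸ N % D) % q    ≡⟨ %-congˡ (cong (D ∸_) N%D≡R) ⟩
        (D ∸ R) % q        ≡⟨ complement-% q (m^n≡m*m^pred[n] q a) (m^n≡m*m^pred[n] q b)
                                (1≤q^ a) (1≤q^ b) (m∸n+n≡m (<⇒≤ R<D)) ⟩
        suc T % q          ≡⟨ +-%-congʳ 1 q T%q≡[1+gcd]%q ⟩
        suc (suc g) % q    ≡⟨ m<n⇒m%n≡m 3+gcd≤q ⟩
        suc (suc g)        ∎

gcd-formulas-2≤b : ∀ {c} → Base c → ∀ a b → 1 ≤ a → 2 ≤ b →
                   .{{_ : NonZero (den c a b)}} .{{_ : NonZero (c ^ (a * b))}} →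
                   GcdFormulas (gcd a b) (c ^ ex a b) (den c a b) (c ^ (a * b))
gcd-formulas-2≤b {c} bc a b 1≤a 2≤b =
  GcdFormulas-cong refl (sym c^ex≡N) (sym den≡D) refl gcdFormulas
  where
  q = c ^ (a * b)
  instance
    a≢0 : NonZero a
    a≢0 = >-nonZero 1≤a
    q≢0 : NonZero q
    q≢0 = pow-nonZero bc (a * b)
  open Expansion q a b
  open Reduction (2[1+a]≤c^[ab] 1≤a 2≤b (base≥2 bc)) 2≤b
  open ≡-Reasoning
  c^ex≡N : c ^ ex a b ≡ N
  c^ex≡N = begin
    c ^ (a * b * (a * b + a + b)) ≡⟨ ^-*-assoc c (a * b) _ ⟨
    q ^ (a * b + a + b)           ≡⟨ cong (q ^_) ((a * b + a + b ≡ a + b * suc a) ∋ solve (a ∷ b ∷ [])) ⟩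
    q ^ (a + b * suc a)           ≡⟨ ^-distribˡ-+-* q a _ ⟩
    A * q ^ (b * suc a)           ≡⟨ cong (A *_) (^-*-assoc q b (suc a)) ⟨
    N                             ∎
  den≡D : den c a b ≡ D
  den≡D = cong₂ (λ m n → (m ∸ 1) * (n ∸ 1))
    (trans (cong (c ^_) ((a * a * b ≡ a * b * a) ∋ solve (a ∷ b ∷ []))) (sym (^-*-assoc c (a * b) a)))
    (sym (^-*-assoc c (a * b) b))

gcd-formulas-comm : ∀ {c a b} .{{_ : NonZero (den c a b)}} .{{_ : NonZero (c ^ (a * b))}}
                    .{{_ : NonZero (den c b a)}} .{{_ : NonZero (c ^ (b * a))}} →
                    GcdFormulas (gcd a b) (c ^ ex a b) (den c a b) (c ^ (a * b)) →
                    GcdFormulas (gcd b a) (c ^ ex b a) (den c b a) (c ^ (b * a))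
gcd-formulas-comm {c} {a} {b} =
  GcdFormulas-cong (gcd-comm a b) (cong (c ^_) (ex-comm a b)) (den-comm c a b) (cong (c ^_) (*-comm a b))

gcd-formulas : ∀ {c} (bc : Base c) a b → 1 ≤ a → 1 ≤ b → ¬ (a ≡ 1 × b ≡ 1) →
               .{{_ : NonZero (den c a b)}} .{{_ : NonZero (c ^ (a * b))}} →
               GcdFormulas (gcd a b) (c ^ ex a b) (den c a b) (c ^ (a * b))
gcd-formulas bc a (suc (suc b)) 1≤a _ _ = gcd-formulas-2≤b bc a (2 + b) 1≤a (s≤s (s≤s z≤n))
gcd-formulas bc 1 1 _ _ ¬1,1 = ⊥-elim (¬1,1 (refl , refl))
gcd-formulas {c} bc (suc (suc a)) (suc zero) _ 1≤b _ =
  gcd-formulas-comm {c} {1} {2 + a} (gcd-formulas-2≤b bc 1 (2 + a) 1≤b (s≤s (s≤s z≤n)))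
  where
  instance
    _ = den-nonZero {c} {1} {2 + a} bc 1≤b (s≤s z≤n)
    _ = pow-nonZero bc (1 * (2 + a))

GcdFormulas⇒ℤ : ∀ {g N D Q} .{{_ : NonZero D}} .{{_ : NonZero Q}} → GcdFormulas g N D Q →
                (+ g ≡ + ((N / D) % Q) - + 1) × (+ g ≡ + (((- + N) %ℕ D) % Q) - + 2)
GcdFormulas⇒ℤ (eq₁ , eq₂) rewrite eq₁ | eq₂ = refl , refl

corollary2 : ∀ {c} (bc : Base c) (a b : ℕ) (ha : 1 ≤ a) (hb : 1 ≤ b) →
    ¬ (a ≡ 1 × b ≡ 1) →
    let instance
          _ = den-nonZero {c} {a} {b} bc ha hb
          _ = pow-nonZero bc (a * b)
    in (+ gcd a b ≡ + (((c ^ ex a b) / den c a b) % (c ^ (a * b))) - + 1)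
       × (+ gcd a b ≡ + (((- + (c ^ ex a b)) %ℕ den c a b) % (c ^ (a * b))) - + 2)
corollary2 bc a b 1≤a 1≤b not-both-1 =
  let instance
        _ = den-nonZero bc 1≤a 1≤b
        _ = pow-nonZero bc (a * b)
  in GcdFormulas⇒ℤ (gcd-formulas bc a b 1≤a 1≤b not-both-1)
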